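{- Let $n\ge 1$ and let $P$ be the $n\times n$ permutation matrix corresponding to a permutation $\pi$ of $\{1,\dots,n\}$ (so $P$ has a $+1$ in position $(i,\pi(i))$ for each $i$). Then $P$ is a maximal ASM if and only if there do not exist integers $p,q,k,l$ with $1\le p<q\le n$ and $1\le k<l\le n$ such that either $$\pi(p)>l,\ \pi(q)<k,\ \pi^{ -1}(k)>q,\ \pi^{ -1}(l)<p,$$ or $$\pi(p)<k,\ \pi(q)>l,\ \pi^{ -1}(k)<p,\ \pi^{ -1}(l)>q.$$
   Context: An alternating sign matrix (ASM) is an $n\times n$ matrix with entries in $\{0,+1,-1\}$ such that in each row and each column the nonzero entries alternate in sign, beginning and ending with $+1$. For $n\times n$ ASMs $A=[a_{ij}]$ and $B=[b_{ij}]$, $B$ is an ASM extension of $A$ if $B\ne A$ and $b_{ij}=a_{ij}$ whenever $a_{ij}\neq 0$. An ASM is maximal if it has no ASM extension. -}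

module Defs where

open import Data.Nat using (ℕ)
open import Data.Integer using (ℤ; +_; -[1+_]; 0ℤ; 1ℤ; -1ℤ)
open import Data.Fin using (Fin; _≟_)
open import Data.Fin.Permutation using (Permutation′; _⟨$⟩ʳ_)
open import Data.List using (List; []; _∷_; tabulate)
open import Data.Product using (Σ; ∃; _×_)
open import Relation.Nullary using (¬_; yes; no)
open import Relation.Binary.PropositionalEquality using (_≡_)

-- n × n integer matrices, indexed (row, column) by Fin n (0-based).
Matrix : ℕ → Set
Matrix n = Fin n → Fin n → ℤ

Entry01 : ℤ → Set
Entry01 x = (x ≡ 0ℤ) Data.Sum.⊎ ((x ≡ 1ℤ) Data.Sum.⊎ (x ≡ -1ℤ))
  where import Data.Sum

nonzeros : List ℤ → List ℤ
nonzeros [] = []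
nonzeros (+ 0 ∷ xs) = nonzeros xs
nonzeros (x ∷ xs) = x ∷ nonzeros xs

data Alternating : List ℤ → Set where
  one  : Alternating (1ℤ ∷ [])
  more : ∀ {xs} → Alternating xs → Alternating (1ℤ ∷ -1ℤ ∷ xs)

row : ∀ {n} → Matrix n → Fin n → List ℤ
row A i = tabulate (λ j → A i j)

col : ∀ {n} → Matrix n → Fin n → List ℤ
col A j = tabulate (λ i → A i j)

IsASM : ∀ {n} → Matrix n → Set
IsASM {n} A =
  (∀ i j → Entry01 (A i j)) ×
  (∀ i → Alternating (nonzeros (row A i))) ×
  (∀ j → Alternating (nonzeros (col A j)))

IsASMExtension : ∀ {n} → Matrix n → Matrix n → Set
IsASMExtension {n} A B =
  IsASM B ×
  (Σ (Fin n) λ i → Σ (Fin n) λ j → ¬ (B i j ≡ A i j)) ×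
  (∀ i j → ¬ (A i j ≡ 0ℤ) → B i j ≡ A i j)

IsMaximalASM : ∀ {n} → Matrix n → Set
IsMaximalASM {n} A = IsASM A × ¬ (Σ (Matrix n) λ B → IsASMExtension A B)

permMatrix : ∀ {n} → Permutation′ n → Matrix n
permMatrix π i j with (π ⟨$⟩ʳ i) ≟ j
... | yes _ = 1ℤ
... | no _  = 0ℤ

module Submission where

-- For a pinwheel, adding ±(e_p − e_q)(e_k − e_l)ᵀ to P turns
--   exactly the four lines of the pinwheel into the shape +1, -1, +1, which
--   gives an ASM extension.
-- * Necessity.  An ASM extension has a topmost row with an extra nonzero
--   entry.  From there a staircase of -1 entries is followed, alternately
--   along rows and columns; its columns move monotonically, so it stops, and
--   it can only stop at a pinwheel.

open import Defs
open import Data.Nat using (ℕ; _≤_)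
open import Data.Fin using (Fin; _<_)
open import Data.Fin.Permutation using (Permutation′; _⟨$⟩ʳ_; _⟨$⟩ˡ_)
open import Data.Product using (Σ; _×_)
open import Data.Sum using (_⊎_)
open import Relation.Nullary using (¬_)
open import Function.Bundles using (_⇔_)

open import Data.Nat as ℕ using (zero; suc; z≤n; s≤s; z<s; s<s)
import Data.Nat.Properties as ℕP
open import Data.Integer as ℤ using (ℤ; +_; -[1+_]; 0ℤ; 1ℤ; -1ℤ)
import Data.Integer.Properties as ℤP
open import Data.Fin as F using (toℕ; fromℕ<; _>_)
open import Data.Fin.Properties using (toℕ-fromℕ<; toℕ-injective; any?)
open import Data.Fin.Induction using (<-wellFounded; >-wellFounded)
open import Data.Fin.Permutation using (inverseˡ; inverseʳ)
open import Data.List using (List; []; _∷_; tabulate; drop)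
open import Data.Product using (_,_; proj₂)
open import Data.Sum using (inj₁; inj₂)
open import Data.Unit using (⊤; tt)
open import Data.Empty using (⊥; ⊥-elim)
open import Function.Bundles using (mk⇔)
open import Induction.WellFounded using (Acc; acc)
open import Relation.Nullary using (yes; no; Dec)
open import Relation.Nullary.Decidable using (¬?; _×-dec_)
open import Relation.Binary.Definitions using (tri<; tri≈; tri>)
open import Relation.Binary.PropositionalEquality using (_≡_; _≢_; refl; sym; trans; cong; cong₂; subst)

-- Reading a list left to right, an alternating sequence of nonzero entries is
-- recognised by a two-state automaton: the state records the sign the next
-- nonzero entry must have.
data Expect : Set where
  plus minus : Expect

AltFrom : Expect → List ℤ → Set
AltFrom plus  []       = ⊥
AltFrom plus  (x ∷ xs) = x ≡ 1ℤ × AltFrom minus xs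
AltFrom minus []       = ⊤
AltFrom minus (x ∷ xs) = x ≡ -1ℤ × AltFrom plus xs

alternating⇒altFrom : ∀ {xs} → Alternating xs → AltFrom plus xs
alternating⇒altFrom one      = refl , tt
alternating⇒altFrom (more a) = refl , refl , alternating⇒altFrom a

altFrom⇒alternating : ∀ {xs} → AltFrom plus xs → Alternating xs
altFrom⇒alternating {_ ∷ []}     (refl , tt)       = one
altFrom⇒alternating {_ ∷ _ ∷ _} (refl , refl , a) = more (altFrom⇒alternating a)

Alt : Expect → List ℤ → Set
Alt s xs = AltFrom s (nonzeros xs)

data Step : Expect → ℤ → Expect → Set where
  skip  : ∀ {s} → Step s 0ℤ s
  plus  : Step plus 1ℤ minus
  minus : Step minus -1ℤ plus

step : ∀ s x xs → Alt s (x ∷ xs) → Σ Expect λ s′ → Step s x s′ × Alt s′ xs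
step s     (+ zero)          xs h          = s , skip , h
step plus  (+ suc zero)      xs (refl , h) = minus , plus , h
step minus -[1+ zero ]       xs (refl , h) = plus , minus , h
step minus (+ suc zero)      xs (() , _)
step plus  (+ suc (suc _))   xs (() , _)
step minus (+ suc (suc _))   xs (() , _)
step plus  -[1+ zero ]       xs (() , _)
step plus  -[1+ suc _ ]      xs (() , _)
step minus -[1+ suc _ ]      xs (() , _)

unstep : ∀ {s x s′ xs} → Step s x s′ → Alt s′ xs → Alt s (x ∷ xs)
unstep skip  h = h
unstep plus  h = refl , h
unstep minus h = refl , h

-- Entry lookup by position, with entries beyond the end reading as 0.
_!_ : List ℤ → ℕ → ℤ
[]       ! _     = 0ℤ
(x ∷ xs) ! zero  = x
(x ∷ xs) ! suc i = xs ! i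

alt-entry : ∀ s xs j → Alt s xs → Entry01 (xs ! j)
alt-entry s [] j h = inj₁ refl
alt-entry s (x ∷ xs) j h with step s x xs h
alt-entry s (x ∷ xs) zero    h | _ , skip  , _ = inj₁ refl
alt-entry s (x ∷ xs) zero    h | _ , plus  , _ = inj₂ (inj₁ refl)
alt-entry s (x ∷ xs) zero    h | _ , minus , _ = inj₂ (inj₂ refl)
alt-entry s (x ∷ xs) (suc j) h | s′ , _ , h′   = alt-entry s′ xs j h′

alt-minus-has-plus-before : ∀ s xs j → Alt s xs → xs ! j ≡ -1ℤ →
  s ≡ minus ⊎ Σ ℕ λ i → i ℕ.< j × xs ! i ≡ 1ℤ
alt-minus-has-plus-before s [] j h ()
alt-minus-has-plus-before s (x ∷ xs) j h e with step s x xs h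
alt-minus-has-plus-before s (x ∷ xs) zero    h () | _ , skip  , _
alt-minus-has-plus-before s (x ∷ xs) zero    h () | _ , plus  , _
alt-minus-has-plus-before s (x ∷ xs) zero    h e  | _ , minus , _ = inj₁ refl
alt-minus-has-plus-before s (x ∷ xs) (suc j) h e  | _ , plus  , _ = inj₂ (0 , z<s , refl)
alt-minus-has-plus-before s (x ∷ xs) (suc j) h e  | _ , skip  , h′
  with alt-minus-has-plus-before s xs j h′ e
... | inj₁ eq             = inj₁ eq
... | inj₂ (i , i<j , ei) = inj₂ (suc i , s<s i<j , ei)
alt-minus-has-plus-before s (x ∷ xs) (suc j) h e  | _ , minus , h′
  with alt-minus-has-plus-before plus xs j h′ e
... | inj₁ ()
... | inj₂ (i , i<j , ei) = inj₂ (suc i , s<s i<j , ei)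

alt-has-plus : ∀ xs → Alt plus xs → Σ ℕ λ i → xs ! i ≡ 1ℤ
alt-has-plus [] ()
alt-has-plus (x ∷ xs) h with step plus x xs h
... | _ , skip , h′ = let (i , e) = alt-has-plus xs h′ in suc i , e
... | _ , plus , _  = 0 , refl

alt-minus-has-plus-after : ∀ s xs j → Alt s xs → xs ! j ≡ -1ℤ →
  Σ ℕ λ i → j ℕ.< i × xs ! i ≡ 1ℤ
alt-minus-has-plus-after s [] j h ()
alt-minus-has-plus-after s (x ∷ xs) j h e with step s x xs h
alt-minus-has-plus-after s (x ∷ xs) zero    h () | _ , skip  , _
alt-minus-has-plus-after s (x ∷ xs) zero    h () | _ , plus  , _
alt-minus-has-plus-after s (x ∷ xs) zero    h e  | _ , minus , h′ =
  let (i , ei) = alt-has-plus xs h′ in suc i , z<s , ei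
alt-minus-has-plus-after s (x ∷ xs) (suc j) h e  | s′ , _ , h′ =
  let (i , j<i , ei) = alt-minus-has-plus-after s′ xs j h′ e in suc i , s<s j<i , ei

alt-plus-has-minus-before : ∀ xs m → Alt minus xs → xs ! m ≡ 1ℤ →
  Σ ℕ λ i → i ℕ.< m × xs ! i ≡ -1ℤ
alt-plus-has-minus-before [] m h ()
alt-plus-has-minus-before (x ∷ xs) m h e with step minus x xs h
alt-plus-has-minus-before (x ∷ xs) zero    h () | _ , skip  , _
alt-plus-has-minus-before (x ∷ xs) zero    h () | _ , minus , _
alt-plus-has-minus-before (x ∷ xs) (suc m) h e  | _ , minus , _  = 0 , z<s , refl
alt-plus-has-minus-before (x ∷ xs) (suc m) h e  | _ , skip  , h′ =
  let (i , i<m , ei) = alt-plus-has-minus-before xs m h′ e in suc i , s<s i<m , ei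

alt-minus-between : ∀ s xs j m → Alt s xs → xs ! j ≡ 1ℤ → xs ! m ≡ 1ℤ → j ℕ.< m →
  Σ ℕ λ i → j ℕ.< i × i ℕ.< m × xs ! i ≡ -1ℤ
alt-minus-between s [] j m h () _ _
alt-minus-between s (x ∷ xs) j m h ej em j<m with step s x xs h
alt-minus-between s (x ∷ xs) zero (suc m) h () em _ | _ , skip  , _
alt-minus-between s (x ∷ xs) zero (suc m) h () em _ | _ , minus , _
alt-minus-between s (x ∷ xs) zero (suc m) h ej em _ | _ , plus  , h′ =
  let (i , i<m , ei) = alt-plus-has-minus-before xs m h′ em in suc i , z<s , s<s i<m , ei
alt-minus-between s (x ∷ xs) (suc j) (suc m) h ej em (s<s j<m) | s′ , _ , h′ =
  let (i , j<i , i<m , ei) = alt-minus-between s′ xs j m h′ ej em j<m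
  in suc i , s<s j<i , s<s i<m , ei

alt-segment : ∀ {s v s′} → Step s v s′ → ∀ xs m j → m ℕ.≤ j →
  (∀ i → m ℕ.≤ i → i ℕ.< j → xs ! i ≡ 0ℤ) → xs ! j ≡ v →
  Alt s′ (drop (suc j) xs) → Alt s (drop m xs)
alt-segment skip  [] zero    j _ _ refl h = h
alt-segment skip  [] (suc m) j _ _ refl h = h
alt-segment plus  [] m j _ _ () h
alt-segment minus [] m j _ _ () h
alt-segment st (x ∷ xs) zero zero _ _ refl h = unstep st h
alt-segment st (x ∷ xs) zero (suc j) _ zeros e h =
  unstep (subst (λ y → Step _ y _) (sym (zeros 0 z≤n z<s)) skip)
    (alt-segment st xs 0 j z≤n (λ i _ i<j → zeros (suc i) z≤n (s<s i<j)) e h)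
alt-segment st (x ∷ xs) (suc m) (suc j) (s≤s m≤j) zeros e h =
  alt-segment st xs m j m≤j (λ i m≤i i<j → zeros (suc i) (s≤s m≤i) (s<s i<j)) e h

alt-zeros : ∀ xs m → (∀ i → m ℕ.≤ i → xs ! i ≡ 0ℤ) → Alt minus (drop m xs)
alt-zeros []       zero    _     = tt
alt-zeros []       (suc m) _     = tt
alt-zeros (x ∷ xs) zero    zeros =
  unstep (subst (λ y → Step minus y minus) (sym (zeros 0 z≤n)) skip)
    (alt-zeros xs 0 (λ i _ → zeros (suc i) z≤n))
alt-zeros (x ∷ xs) (suc m) zeros = alt-zeros xs m (λ i m≤i → zeros (suc i) (s≤s m≤i))

alt-single : ∀ xs a → xs ! a ≡ 1ℤ → (∀ i → i ≢ a → xs ! i ≡ 0ℤ) → Alt plus xs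
alt-single xs a ea zeros =
  alt-segment plus xs 0 a z≤n (λ i _ i<a → zeros i (ℕP.<⇒≢ i<a)) ea
  (alt-zeros xs (suc a) (λ i a<i → zeros i (ℕP.>⇒≢ a<i)))

alt-triple : ∀ xs a b c → a ℕ.< b → b ℕ.< c →
  xs ! a ≡ 1ℤ → xs ! b ≡ -1ℤ → xs ! c ≡ 1ℤ →
  (∀ i → i ≢ a → i ≢ b → i ≢ c → xs ! i ≡ 0ℤ) → Alt plus xs
alt-triple xs a b c a<b b<c ea eb ec zeros =
  alt-segment plus xs 0 a z≤n
    (λ i _ i<a → zeros i (ℕP.<⇒≢ i<a) (ℕP.<⇒≢ (ℕP.<-trans i<a a<b))
                         (ℕP.<⇒≢ (ℕP.<-trans i<a a<c))) ea
  (alt-segment minus xs (suc a) b a<b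
    (λ i a<i i<b → zeros i (ℕP.>⇒≢ a<i) (ℕP.<⇒≢ i<b) (ℕP.<⇒≢ (ℕP.<-trans i<b b<c))) eb
  (alt-segment plus xs (suc b) c b<c
    (λ i b<i i<c → zeros i (ℕP.>⇒≢ (ℕP.<-trans a<b b<i)) (ℕP.>⇒≢ b<i) (ℕP.<⇒≢ i<c)) ec
  (alt-zeros xs (suc c)
    (λ i c<i → zeros i (ℕP.>⇒≢ (ℕP.<-trans a<c c<i)) (ℕP.>⇒≢ (ℕP.<-trans b<c c<i))
                       (ℕP.>⇒≢ c<i)))))
  where
  a<c : a ℕ.< c
  a<c = ℕP.<-trans a<b b<c

AltVec : ∀ {n} → (Fin n → ℤ) → Set
AltVec g = Alternating (nonzeros (tabulate g))

tabulate-! : ∀ {n} (g : Fin n → ℤ) i → tabulate g ! toℕ i ≡ g i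
tabulate-! g F.zero    = refl
tabulate-! g (F.suc i) = tabulate-! (λ j → g (F.suc j)) i

tabulate-!-beyond : ∀ {n} (g : Fin n → ℤ) m → n ℕ.≤ m → tabulate g ! m ≡ 0ℤ
tabulate-!-beyond {zero}  g m       _         = refl
tabulate-!-beyond {suc n} g (suc m) (s≤s n≤m) = tabulate-!-beyond (λ j → g (F.suc j)) m n≤m

tabulate-!-nonzero : ∀ {n} (g : Fin n → ℤ) m {v} → tabulate g ! m ≡ v → v ≢ 0ℤ →
  Σ (Fin n) λ i → toℕ i ≡ m × g i ≡ v
tabulate-!-nonzero {n} g m e v≢0 with m ℕ.<? n
... | yes m<n = fromℕ< m<n , toℕ-fromℕ< m<n ,
      trans (sym (tabulate-! g (fromℕ< m<n)))
            (trans (cong (tabulate g !_) (toℕ-fromℕ< m<n)) e)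
... | no m≮n = ⊥-elim (v≢0 (trans (sym e) (tabulate-!-beyond g m (ℕP.≮⇒≥ m≮n))))

tabulate-!-zero : ∀ {n} (g : Fin n → ℤ) m → (∀ i → toℕ i ≡ m → g i ≡ 0ℤ) →
  tabulate g ! m ≡ 0ℤ
tabulate-!-zero {n} g m zeros with m ℕ.<? n
... | yes m<n = trans (cong (tabulate g !_) (sym (toℕ-fromℕ< m<n)))
                  (trans (tabulate-! g (fromℕ< m<n)) (zeros (fromℕ< m<n) (toℕ-fromℕ< m<n)))
... | no m≮n = tabulate-!-beyond g m (ℕP.≮⇒≥ m≮n)

vec-entry : ∀ {n} (g : Fin n → ℤ) → AltVec g → ∀ j → Entry01 (g j)
vec-entry g a j =
  subst Entry01 (tabulate-! g j) (alt-entry plus (tabulate g) (toℕ j) (alternating⇒altFrom a))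

vec-minus-has-plus-before : ∀ {n} (g : Fin n → ℤ) → AltVec g → ∀ j → g j ≡ -1ℤ →
  Σ (Fin n) λ i → i < j × g i ≡ 1ℤ
vec-minus-has-plus-before g a j e
  with alt-minus-has-plus-before plus (tabulate g) (toℕ j) (alternating⇒altFrom a)
         (trans (tabulate-! g j) e)
... | inj₁ ()
... | inj₂ (m , m<j , em) with tabulate-!-nonzero g m em (λ ())
...   | i , refl , ei = i , m<j , ei

vec-minus-has-plus-after : ∀ {n} (g : Fin n → ℤ) → AltVec g → ∀ j → g j ≡ -1ℤ →
  Σ (Fin n) λ i → j < i × g i ≡ 1ℤ
vec-minus-has-plus-after g a j e
  with alt-minus-has-plus-after plus (tabulate g) (toℕ j) (alternating⇒altFrom a)
         (trans (tabulate-! g j) e)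
... | m , j<m , em with tabulate-!-nonzero g m em (λ ())
...   | i , refl , ei = i , j<m , ei

vec-minus-between : ∀ {n} (g : Fin n → ℤ) → AltVec g → ∀ j m → g j ≡ 1ℤ → g m ≡ 1ℤ → j < m →
  Σ (Fin n) λ i → j < i × i < m × g i ≡ -1ℤ
vec-minus-between g a j m ej em j<m
  with alt-minus-between plus (tabulate g) (toℕ j) (toℕ m) (alternating⇒altFrom a)
         (trans (tabulate-! g j) ej) (trans (tabulate-! g m) em) j<m
... | k , j<k , k<m , ek with tabulate-!-nonzero g k ek (λ ())
...   | i , refl , ei = i , j<k , k<m , ei

vec-single : ∀ {n} (g : Fin n → ℤ) a → g a ≡ 1ℤ → (∀ i → i ≢ a → g i ≡ 0ℤ) → AltVec g
vec-single g a ea zeros = altFrom⇒alternating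
  (alt-single (tabulate g) (toℕ a) (trans (tabulate-! g a) ea)
    (λ m m≢a → tabulate-!-zero g m (λ { i refl → zeros i (λ { refl → m≢a refl }) })))

vec-triple : ∀ {n} (g : Fin n → ℤ) a b c → a < b → b < c →
  g a ≡ 1ℤ → g b ≡ -1ℤ → g c ≡ 1ℤ → (∀ i → i ≢ a → i ≢ b → i ≢ c → g i ≡ 0ℤ) → AltVec g
vec-triple g a b c a<b b<c ea eb ec zeros = altFrom⇒alternating
  (alt-triple (tabulate g) (toℕ a) (toℕ b) (toℕ c) a<b b<c
    (trans (tabulate-! g a) ea) (trans (tabulate-! g b) eb) (trans (tabulate-! g c) ec)
    (λ m m≢a m≢b m≢c → tabulate-!-zero g m (λ { i refl →
       zeros i (λ { refl → m≢a refl }) (λ { refl → m≢b refl }) (λ { refl → m≢c refl }) })))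

-- The pattern of the theorem: rows p < q and columns k < l whose four lines
-- leave the box p,q × k,l in a pinwheel, i.e. the 1s of rows p, q and of
-- columns k, l lie outside the box on four different sides.
Pinwheel : ∀ {n} → Permutation′ n → (p q k l : Fin n) → Set
Pinwheel π p q k l =
  (l < π ⟨$⟩ʳ p × π ⟨$⟩ʳ q < k × q < π ⟨$⟩ˡ k × π ⟨$⟩ˡ l < p)
  ⊎ (π ⟨$⟩ʳ p < k × l < π ⟨$⟩ʳ q × π ⟨$⟩ˡ k < p × q < π ⟨$⟩ˡ l)

HasPinwheel : ∀ {n} → Permutation′ n → Set
HasPinwheel {n} π = Σ (Fin n) λ p → Σ (Fin n) λ q → Σ (Fin n) λ k → Σ (Fin n) λ l →
  p < q × k < l × Pinwheel π p q k l

module _ {n} (π : Permutation′ n) where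

  permMatrix-row-one : ∀ i → permMatrix π i (π ⟨$⟩ʳ i) ≡ 1ℤ
  permMatrix-row-one i with (π ⟨$⟩ʳ i) F.≟ (π ⟨$⟩ʳ i)
  ... | yes _ = refl
  ... | no ne = ⊥-elim (ne refl)

  permMatrix-row-zero : ∀ i j → j ≢ π ⟨$⟩ʳ i → permMatrix π i j ≡ 0ℤ
  permMatrix-row-zero i j j≢ with (π ⟨$⟩ʳ i) F.≟ j
  ... | yes e = ⊥-elim (j≢ (sym e))
  ... | no _  = refl

  inverse-of : ∀ {i j} → j ≡ π ⟨$⟩ʳ i → π ⟨$⟩ˡ j ≡ i
  inverse-of refl = inverseˡ π

  permMatrix-col-one : ∀ j → permMatrix π (π ⟨$⟩ˡ j) j ≡ 1ℤ
  permMatrix-col-one j =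
    subst (λ x → permMatrix π (π ⟨$⟩ˡ j) x ≡ 1ℤ) (inverseʳ π) (permMatrix-row-one (π ⟨$⟩ˡ j))

  permMatrix-col-zero : ∀ i j → i ≢ π ⟨$⟩ˡ j → permMatrix π i j ≡ 0ℤ
  permMatrix-col-zero i j i≢ = permMatrix-row-zero i j (λ e → i≢ (sym (inverse-of e)))

  permMatrix-isASM : IsASM (permMatrix π)
  permMatrix-isASM = (λ i j → vec-entry (permMatrix π i) (rows i) j) , rows , cols
    where
    rows : ∀ i → AltVec (permMatrix π i)
    rows i = vec-single (permMatrix π i) (π ⟨$⟩ʳ i) (permMatrix-row-one i) (permMatrix-row-zero i)
    cols : ∀ j → AltVec (λ i → permMatrix π i j)
    cols j = vec-single (λ i → permMatrix π i j) (π ⟨$⟩ˡ j) (permMatrix-col-one j)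
               (λ i → permMatrix-col-zero i j)

δ : ∀ {n} → Fin n → Fin n → ℤ
δ x y with x F.≟ y
... | yes _ = 1ℤ
... | no _  = 0ℤ

δ-same : ∀ {n} (x : Fin n) → δ x x ≡ 1ℤ
δ-same x with x F.≟ x
... | yes _ = refl
... | no ne = ⊥-elim (ne refl)

δ-diff : ∀ {n} {x y : Fin n} → x ≢ y → δ x y ≡ 0ℤ
δ-diff {x = x} {y} x≢y with x F.≟ y
... | yes e = ⊥-elim (x≢y e)
... | no _  = refl

≢-sym : ∀ {A : Set} {x y : A} → x ≢ y → y ≢ x
≢-sym x≢y e = x≢y (sym e)

-- The switch of P = permMatrix π at rows p, q and columns k₊, k₋ (all four
-- positions being zeros of P) adds the rank-one matrix (e_p − e_q)(e_{k₊} − e_{k₋})ᵀ: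
--   +1 at (p,k₊) and (q,k₋),  -1 at (p,k₋) and (q,k₊).
-- Only rows p, q and columns k₊, k₋ change, and each of them acquires
-- exactly three nonzero entries; so if these four lines alternate, the
-- switch is an ASM extension of P.
module Switch {n} (π : Permutation′ n) (p q k₊ k₋ : Fin n) (p≢q : p ≢ q) (k₊≢k₋ : k₊ ≢ k₋)
  (k₊≢πp : k₊ ≢ π ⟨$⟩ʳ p) (k₋≢πp : k₋ ≢ π ⟨$⟩ʳ p)
  (k₊≢πq : k₊ ≢ π ⟨$⟩ʳ q) (k₋≢πq : k₋ ≢ π ⟨$⟩ʳ q) where

  P : Matrix n
  P = permMatrix π

  rowSign : Fin n → ℤ
  rowSign i = δ i p ℤ.- δ i q

  colSign : Fin n → ℤ
  colSign j = δ j k₊ ℤ.- δ j k₋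

  B : Matrix n
  B i j = P i j ℤ.+ rowSign i ℤ.* colSign j

  rowSign-p : rowSign p ≡ 1ℤ
  rowSign-p = cong₂ ℤ._-_ (δ-same p) (δ-diff p≢q)
  rowSign-q : rowSign q ≡ -1ℤ
  rowSign-q = cong₂ ℤ._-_ (δ-diff (≢-sym p≢q)) (δ-same q)
  rowSign-other : ∀ {i} → i ≢ p → i ≢ q → rowSign i ≡ 0ℤ
  rowSign-other i≢p i≢q = cong₂ ℤ._-_ (δ-diff i≢p) (δ-diff i≢q)

  colSign-k₊ : colSign k₊ ≡ 1ℤ
  colSign-k₊ = cong₂ ℤ._-_ (δ-same k₊) (δ-diff k₊≢k₋)
  colSign-k₋ : colSign k₋ ≡ -1ℤ
  colSign-k₋ = cong₂ ℤ._-_ (δ-diff (≢-sym k₊≢k₋)) (δ-same k₋)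
  colSign-other : ∀ {j} → j ≢ k₊ → j ≢ k₋ → colSign j ≡ 0ℤ
  colSign-other j≢k₊ j≢k₋ = cong₂ ℤ._-_ (δ-diff j≢k₊) (δ-diff j≢k₋)

  B-value : ∀ {i j x y z} → P i j ≡ x → rowSign i ≡ y → colSign j ≡ z → B i j ≡ x ℤ.+ y ℤ.* z
  B-value e₁ e₂ e₃ = cong₂ ℤ._+_ e₁ (cong₂ ℤ._*_ e₂ e₃)

  B-row-unchanged : ∀ {i} → i ≢ p → i ≢ q → ∀ j → B i j ≡ P i j
  B-row-unchanged {i} i≢p i≢q j =
    trans (cong (λ x → P i j ℤ.+ x ℤ.* colSign j) (rowSign-other i≢p i≢q)) (ℤP.+-identityʳ (P i j))

  B-col-unchanged : ∀ {j} → j ≢ k₊ → j ≢ k₋ → ∀ i → B i j ≡ P i j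
  B-col-unchanged {j} j≢k₊ j≢k₋ i =
    trans (cong (λ x → P i j ℤ.+ rowSign i ℤ.* x) (colSign-other j≢k₊ j≢k₋))
      (trans (cong (λ x → P i j ℤ.+ x) (ℤP.*-zeroʳ (rowSign i))) (ℤP.+-identityʳ (P i j)))

  B-p-k₊ : B p k₊ ≡ 1ℤ
  B-p-k₊ = B-value (permMatrix-row-zero π p k₊ k₊≢πp) rowSign-p colSign-k₊
  B-p-k₋ : B p k₋ ≡ -1ℤ
  B-p-k₋ = B-value (permMatrix-row-zero π p k₋ k₋≢πp) rowSign-p colSign-k₋
  B-p-πp : B p (π ⟨$⟩ʳ p) ≡ 1ℤ
  B-p-πp = B-value (permMatrix-row-one π p) rowSign-p (colSign-other (≢-sym k₊≢πp) (≢-sym k₋≢πp))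
  B-p-other : ∀ j → j ≢ k₊ → j ≢ k₋ → j ≢ π ⟨$⟩ʳ p → B p j ≡ 0ℤ
  B-p-other j j≢k₊ j≢k₋ j≢πp =
    B-value (permMatrix-row-zero π p j j≢πp) rowSign-p (colSign-other j≢k₊ j≢k₋)

  B-q-k₊ : B q k₊ ≡ -1ℤ
  B-q-k₊ = B-value (permMatrix-row-zero π q k₊ k₊≢πq) rowSign-q colSign-k₊
  B-q-k₋ : B q k₋ ≡ 1ℤ
  B-q-k₋ = B-value (permMatrix-row-zero π q k₋ k₋≢πq) rowSign-q colSign-k₋
  B-q-πq : B q (π ⟨$⟩ʳ q) ≡ 1ℤ
  B-q-πq = B-value (permMatrix-row-one π q) rowSign-q (colSign-other (≢-sym k₊≢πq) (≢-sym k₋≢πq))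
  B-q-other : ∀ j → j ≢ k₊ → j ≢ k₋ → j ≢ π ⟨$⟩ʳ q → B q j ≡ 0ℤ
  B-q-other j j≢k₊ j≢k₋ j≢πq =
    B-value (permMatrix-row-zero π q j j≢πq) rowSign-q (colSign-other j≢k₊ j≢k₋)

  not-inverse : ∀ {i j} → j ≢ π ⟨$⟩ʳ i → π ⟨$⟩ˡ j ≢ i
  not-inverse j≢πi e = j≢πi (trans (sym (inverseʳ π)) (cong (π ⟨$⟩ʳ_) e))

  B-π⁻¹k₊-k₊ : B (π ⟨$⟩ˡ k₊) k₊ ≡ 1ℤ
  B-π⁻¹k₊-k₊ = B-value (permMatrix-col-one π k₊)
    (rowSign-other (not-inverse k₊≢πp) (not-inverse k₊≢πq)) colSign-k₊
  B-k₊-other : ∀ i → i ≢ p → i ≢ q → i ≢ π ⟨$⟩ˡ k₊ → B i k₊ ≡ 0ℤ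
  B-k₊-other i i≢p i≢q i≢ =
    B-value (permMatrix-col-zero π i k₊ i≢) (rowSign-other i≢p i≢q) colSign-k₊

  B-π⁻¹k₋-k₋ : B (π ⟨$⟩ˡ k₋) k₋ ≡ 1ℤ
  B-π⁻¹k₋-k₋ = B-value (permMatrix-col-one π k₋)
    (rowSign-other (not-inverse k₋≢πp) (not-inverse k₋≢πq)) colSign-k₋
  B-k₋-other : ∀ i → i ≢ p → i ≢ q → i ≢ π ⟨$⟩ˡ k₋ → B i k₋ ≡ 0ℤ
  B-k₋-other i i≢p i≢q i≢ =
    B-value (permMatrix-col-zero π i k₋ i≢) (rowSign-other i≢p i≢q) colSign-k₋

  switch-extends : AltVec (B p) → AltVec (B q) →
    AltVec (λ i → B i k₊) → AltVec (λ i → B i k₋) → IsASMExtension P B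
  switch-extends alt-p alt-q alt-k₊ alt-k₋ =
    ((λ i j → vec-entry (B i) (rows i) j) , rows , cols) , (p , k₊ , changed) , keeps-ones
    where
    rows′ : ∀ i → Dec (i ≡ p) → Dec (i ≡ q) → AltVec (B i)
    rows′ _ (yes refl) _          = alt-p
    rows′ _ (no _)     (yes refl) = alt-q
    rows′ i (no i≢p)   (no i≢q)   =
      vec-single (B i) (π ⟨$⟩ʳ i) (trans (B-row-unchanged i≢p i≢q _) (permMatrix-row-one π i))
        (λ j j≢ → trans (B-row-unchanged i≢p i≢q j) (permMatrix-row-zero π i j j≢))
    rows : ∀ i → AltVec (B i)
    rows i = rows′ i (i F.≟ p) (i F.≟ q)
    cols′ : ∀ j → Dec (j ≡ k₊) → Dec (j ≡ k₋) → AltVec (λ i → B i j)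
    cols′ _ (yes refl) _          = alt-k₊
    cols′ _ (no _)     (yes refl) = alt-k₋
    cols′ j (no j≢k₊)  (no j≢k₋)  =
      vec-single (λ i → B i j) (π ⟨$⟩ˡ j)
        (trans (B-col-unchanged j≢k₊ j≢k₋ _) (permMatrix-col-one π j))
        (λ i i≢ → trans (B-col-unchanged j≢k₊ j≢k₋ i) (permMatrix-col-zero π i j i≢))
    cols : ∀ j → AltVec (λ i → B i j)
    cols j = cols′ j (j F.≟ k₊) (j F.≟ k₋)
    changed : B p k₊ ≢ P p k₊
    changed e with trans (sym B-p-k₊) (trans e (permMatrix-row-zero π p k₊ k₊≢πp))
    ... | ()
    keeps-row-one : ∀ i → Dec (i ≡ p) → Dec (i ≡ q) → B i (π ⟨$⟩ʳ i) ≡ P i (π ⟨$⟩ʳ i)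
    keeps-row-one _ (yes refl) _          = trans B-p-πp (sym (permMatrix-row-one π p))
    keeps-row-one _ (no _)     (yes refl) = trans B-q-πq (sym (permMatrix-row-one π q))
    keeps-row-one i (no i≢p)   (no i≢q)   = B-row-unchanged i≢p i≢q (π ⟨$⟩ʳ i)
    keeps-ones : ∀ i j → P i j ≢ 0ℤ → B i j ≡ P i j
    keeps-ones i j nz with j F.≟ π ⟨$⟩ʳ i
    ... | no j≢  = ⊥-elim (nz (permMatrix-row-zero π i j j≢))
    ... | yes refl = keeps-row-one i (i F.≟ p) (i F.≟ q)

<⇒≢ : ∀ {n} {x y : Fin n} → x < y → x ≢ y
<⇒≢ x<y refl = ℕP.<-irrefl refl x<y

-- In the first shape switch at k₊ = k, k₋ = l, in the second at k₊ = l, k₋ = k;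
-- the order of the outside 1s makes each changed line read +1, -1, +1.
pinwheel⇒extension : ∀ {n} (π : Permutation′ n) → HasPinwheel π →
  Σ (Matrix n) λ B → IsASMExtension (permMatrix π) B
pinwheel⇒extension π (p , q , k , l , p<q , k<l , inj₁ (l<πp , πq<k , q<π⁻¹k , π⁻¹l<p)) =
  B , switch-extends
    (vec-triple (B p) k l (π ⟨$⟩ʳ p) k<l l<πp B-p-k₊ B-p-k₋ B-p-πp B-p-other)
    (vec-triple (B q) (π ⟨$⟩ʳ q) k l πq<k k<l B-q-πq B-q-k₊ B-q-k₋
      (λ j j≢πq j≢k j≢l → B-q-other j j≢k j≢l j≢πq))
    (vec-triple (λ i → B i k) p q (π ⟨$⟩ˡ k) p<q q<π⁻¹k B-p-k₊ B-q-k₊ B-π⁻¹k₊-k₊ B-k₊-other)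
    (vec-triple (λ i → B i l) (π ⟨$⟩ˡ l) p q π⁻¹l<p p<q B-π⁻¹k₋-k₋ B-p-k₋ B-q-k₋
      (λ i i≢π⁻¹l i≢p i≢q → B-k₋-other i i≢p i≢q i≢π⁻¹l))
  where
  open Switch π p q k l (<⇒≢ p<q) (<⇒≢ k<l)
    (<⇒≢ (ℕP.<-trans k<l l<πp)) (<⇒≢ l<πp) (≢-sym (<⇒≢ πq<k)) (≢-sym (<⇒≢ (ℕP.<-trans πq<k k<l)))
pinwheel⇒extension π (p , q , k , l , p<q , k<l , inj₂ (πp<k , l<πq , π⁻¹k<p , q<π⁻¹l)) =
  B , switch-extends
    (vec-triple (B p) (π ⟨$⟩ʳ p) k l πp<k k<l B-p-πp B-p-k₋ B-p-k₊
      (λ j j≢πp j≢k j≢l → B-p-other j j≢l j≢k j≢πp))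
    (vec-triple (B q) k l (π ⟨$⟩ʳ q) k<l l<πq B-q-k₋ B-q-k₊ B-q-πq
      (λ j j≢k j≢l j≢πq → B-q-other j j≢l j≢k j≢πq))
    (vec-triple (λ i → B i l) p q (π ⟨$⟩ˡ l) p<q q<π⁻¹l B-p-k₊ B-q-k₊ B-π⁻¹k₊-k₊ B-k₊-other)
    (vec-triple (λ i → B i k) (π ⟨$⟩ˡ k) p q π⁻¹k<p p<q B-π⁻¹k₋-k₋ B-p-k₋ B-q-k₋
      (λ i i≢π⁻¹k i≢p i≢q → B-k₋-other i i≢p i≢q i≢π⁻¹k))
  where
  open Switch π p q l k (<⇒≢ p<q) (≢-sym (<⇒≢ k<l))
    (≢-sym (<⇒≢ (ℕP.<-trans πp<k k<l))) (≢-sym (<⇒≢ πp<k)) (<⇒≢ l<πq) (<⇒≢ (ℕP.<-trans k<l l<πq))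

1≢0 : 1ℤ ≢ 0ℤ
1≢0 ()

-1≢0 : -1ℤ ≢ 0ℤ
-1≢0 ()

module Staircase {n} (π : Permutation′ n) (B : Matrix n)
  (row-alt : ∀ i → AltVec (B i))
  (col-alt : ∀ j → AltVec (λ i → B i j))
  (row-one : ∀ i → B i (π ⟨$⟩ʳ i) ≡ 1ℤ) where

  col-of : Fin n → Fin n
  col-of i = π ⟨$⟩ʳ i

  row-of : Fin n → Fin n
  row-of j = π ⟨$⟩ˡ j

  col-one : ∀ j → B (row-of j) j ≡ 1ℤ
  col-one j = subst (λ x → B (row-of j) x ≡ 1ℤ) (inverseʳ π) (row-one (row-of j))

  above-or-below : ∀ i j → j ≢ col-of i → i < row-of j ⊎ row-of j < i
  above-or-below i j j≢ with ℕP.<-cmp (toℕ i) (toℕ (row-of j))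
  ... | tri< i<  _ _ = inj₁ i<
  ... | tri≈ _ i≡ _  = ⊥-elim (j≢ (trans (sym (inverseʳ π)) (cong col-of (sym (toℕ-injective i≡)))))
  ... | tri> _ _ i>  = inj₂ i>

  left-or-right : ∀ i j → j ≢ col-of i → j < col-of i ⊎ col-of i < j
  left-or-right i j j≢ with ℕP.<-cmp (toℕ j) (toℕ (col-of i))
  ... | tri< j<  _ _ = inj₁ j<
  ... | tri≈ _ j≡ _  = ⊥-elim (j≢ (toℕ-injective j≡))
  ... | tri> _ _ j>  = inj₂ j>

  above⇒off : ∀ {i j} → i < row-of j → j ≢ col-of i
  above⇒off i< refl = <⇒≢ i< (sym (inverseˡ π))

  below⇒off : ∀ {i j} → row-of j < i → j ≢ col-of i
  below⇒off i> refl = <⇒≢ i> (inverseˡ π)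

  left⇒off : ∀ {i j} → j < col-of i → j ≢ col-of i
  left⇒off = <⇒≢

  right⇒off : ∀ {i j} → col-of i < j → j ≢ col-of i
  right⇒off j> = ≢-sym (<⇒≢ j>)

  -- Corners.  (a, b) is a north-east corner of the cell (r, c) when a is
  -- weakly above r, b weakly right of c, and the 1s of row a and column b
  -- leave the cell (a, b) to the right and upwards; likewise for the other
  -- three directions.  A corner is one half of a pinwheel: the staircase
  -- carries corners along and closes a pinwheel with one of them.
  NE SE NW SW : Fin n → Fin n → Set
  NE r c = Σ (Fin n) λ a → Σ (Fin n) λ b → a F.≤ r × c F.≤ b × b < col-of a × row-of b < a
  SE r c = Σ (Fin n) λ a → Σ (Fin n) λ b → r F.≤ a × c F.≤ b × b < col-of a × a < row-of b
  NW r c = Σ (Fin n) λ a → Σ (Fin n) λ b → a F.≤ r × b F.≤ c × col-of a < b × row-of b < a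
  SW r c = Σ (Fin n) λ a → Σ (Fin n) λ b → r F.≤ a × b F.≤ c × col-of a < b × a < row-of b

  NE-shift : ∀ {r c r′ c′} → NE r c → r < r′ → c′ < c → NE r′ c′
  NE-shift (a , b , a≤r , c≤b , x , y) r<r′ c′<c =
    a , b , ℕP.<⇒≤ (ℕP.≤-<-trans a≤r r<r′) , ℕP.<⇒≤ (ℕP.<-≤-trans c′<c c≤b) , x , y
  SE-shift : ∀ {r c r′ c′} → SE r c → r′ < r → c′ < c → SE r′ c′
  SE-shift (a , b , r≤a , c≤b , x , y) r′<r c′<c =
    a , b , ℕP.<⇒≤ (ℕP.<-≤-trans r′<r r≤a) , ℕP.<⇒≤ (ℕP.<-≤-trans c′<c c≤b) , x , y
  NW-shift : ∀ {r c r′ c′} → NW r c → r < r′ → c < c′ → NW r′ c′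
  NW-shift (a , b , a≤r , b≤c , x , y) r<r′ c<c′ =
    a , b , ℕP.<⇒≤ (ℕP.≤-<-trans a≤r r<r′) , ℕP.<⇒≤ (ℕP.≤-<-trans b≤c c<c′) , x , y
  SW-shift : ∀ {r c r′ c′} → SW r c → r′ < r → c < c′ → SW r′ c′
  SW-shift (a , b , r≤a , b≤c , x , y) r′<r c<c′ =
    a , b , ℕP.<⇒≤ (ℕP.<-≤-trans r′<r r≤a) , ℕP.<⇒≤ (ℕP.≤-<-trans b≤c c<c′) , x , y

  column-minus-between : ∀ r c → B r c ≡ 1ℤ → c ≢ col-of r → Σ (Fin n) λ r′ → B r′ c ≡ -1ℤ ×
    ((r < r′ × r′ < row-of c) ⊎ (row-of c < r′ × r′ < r))
  column-minus-between r c e c≢ with above-or-below r c c≢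
  ... | inj₁ r<ρ = let (r′ , r<r′ , r′<ρ , e′) = vec-minus-between (λ i → B i c) (col-alt c) r (row-of c) e (col-one c) r<ρ
                   in r′ , e′ , inj₁ (r<r′ , r′<ρ)
  ... | inj₂ ρ<r = let (r′ , ρ<r′ , r′<r , e′) = vec-minus-between (λ i → B i c) (col-alt c) (row-of c) r (col-one c) e ρ<r
                   in r′ , e′ , inj₂ (ρ<r′ , r′<r)

  -- At a -1 in cell (r, c) left of its row's 1, with a
  -- north-east and a south-east corner in hand, take a +1 further left in
  -- row r, at column c′, and the -1 of column c′ that separates it from the
  -- column's 1, in row r′.  If the 1 of row r′ lies left of c′, the corner
  -- behind the move (north-east after moving down, south-east after moving
  -- up) closes a pinwheel with row r′ and column c′; otherwise (r′, c′) is
  -- the next cell of the staircase and is itself a new corner of the other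
  -- kind.  Columns strictly decrease, so the staircase ends.
  walk-left : ∀ r c → Acc _<_ c → B r c ≡ -1ℤ → c < col-of r → NE r c → SE r c → HasPinwheel π
  descend-left : ∀ {r c r′ c′} → Acc _<_ c′ → B r′ c′ ≡ -1ℤ → r′ < row-of c′ →
    NE r c → r < r′ → c′ < c → HasPinwheel π
  ascend-left : ∀ {r c r′ c′} → Acc _<_ c′ → B r′ c′ ≡ -1ℤ → row-of c′ < r′ →
    SE r c → r′ < r → c′ < c → HasPinwheel π

  walk-left r c (acc smaller) e c<πr ne se
    with vec-minus-has-plus-before (B r) (row-alt r) c e
  ... | c′ , c′<c , e′ with column-minus-between r c′ e′ (left⇒off (ℕP.<-trans c′<c c<πr))
  ...   | r′ , e″ , inj₁ (r<r′ , r′<ρ) = descend-left (smaller c′<c) e″ r′<ρ ne r<r′ c′<c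
  ...   | r′ , e″ , inj₂ (ρ<r′ , r′<r) = ascend-left (smaller c′<c) e″ ρ<r′ se r′<r c′<c

  descend-left {r′ = r′} {c′} next e r′<ρ ne r<r′ c′<c with left-or-right r′ c′ (above⇒off r′<ρ)
  ... | inj₁ c′<πr′ =
    walk-left r′ c′ next e c′<πr′ (NE-shift ne r<r′ c′<c) (r′ , c′ , ℕP.≤-refl , ℕP.≤-refl , c′<πr′ , r′<ρ)
  ... | inj₂ πr′<c′ = let (a , b , a≤r , c≤b , b<πa , ρb<a) = ne in
    a , r′ , c′ , b , ℕP.≤-<-trans a≤r r<r′ , ℕP.<-≤-trans c′<c c≤b , inj₁ (b<πa , πr′<c′ , r′<ρ , ρb<a)

  ascend-left {r′ = r′} {c′} next e ρ<r′ se r′<r c′<c with left-or-right r′ c′ (below⇒off ρ<r′)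
  ... | inj₁ c′<πr′ =
    walk-left r′ c′ next e c′<πr′ (r′ , c′ , ℕP.≤-refl , ℕP.≤-refl , c′<πr′ , ρ<r′) (SE-shift se r′<r c′<c)
  ... | inj₂ πr′<c′ = let (a , b , r≤a , c≤b , b<πa , a<ρb) = se in
    r′ , a , c′ , b , ℕP.<-≤-trans r′<r r≤a , ℕP.<-≤-trans c′<c c≤b , inj₂ (πr′<c′ , b<πa , ρ<r′ , a<ρb)

  walk-right : ∀ r c → Acc _>_ c → B r c ≡ -1ℤ → col-of r < c → NW r c → SW r c → HasPinwheel π
  descend-right : ∀ {r c r′ c′} → Acc _>_ c′ → B r′ c′ ≡ -1ℤ → r′ < row-of c′ →
    NW r c → r < r′ → c < c′ → HasPinwheel π
  ascend-right : ∀ {r c r′ c′} → Acc _>_ c′ → B r′ c′ ≡ -1ℤ → row-of c′ < r′ →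
    SW r c → r′ < r → c < c′ → HasPinwheel π

  walk-right r c (acc larger) e πr<c nw sw
    with vec-minus-has-plus-after (B r) (row-alt r) c e
  ... | c′ , c<c′ , e′ with column-minus-between r c′ e′ (right⇒off (ℕP.<-trans πr<c c<c′))
  ...   | r′ , e″ , inj₁ (r<r′ , r′<ρ) = descend-right (larger c<c′) e″ r′<ρ nw r<r′ c<c′
  ...   | r′ , e″ , inj₂ (ρ<r′ , r′<r) = ascend-right (larger c<c′) e″ ρ<r′ sw r′<r c<c′

  descend-right {r′ = r′} {c′} next e r′<ρ nw r<r′ c<c′ with left-or-right r′ c′ (above⇒off r′<ρ)
  ... | inj₂ πr′<c′ =
    walk-right r′ c′ next e πr′<c′ (NW-shift nw r<r′ c<c′) (r′ , c′ , ℕP.≤-refl , ℕP.≤-refl , πr′<c′ , r′<ρ)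
  ... | inj₁ c′<πr′ = let (a , b , a≤r , b≤c , πa<b , ρb<a) = nw in
    a , r′ , b , c′ , ℕP.≤-<-trans a≤r r<r′ , ℕP.≤-<-trans b≤c c<c′ , inj₂ (πa<b , c′<πr′ , ρb<a , r′<ρ)

  ascend-right {r′ = r′} {c′} next e ρ<r′ sw r′<r c<c′ with left-or-right r′ c′ (below⇒off ρ<r′)
  ... | inj₂ πr′<c′ =
    walk-right r′ c′ next e πr′<c′ (r′ , c′ , ℕP.≤-refl , ℕP.≤-refl , πr′<c′ , ρ<r′) (SW-shift sw r′<r c<c′)
  ... | inj₁ c′<πr′ = let (a , b , r≤a , b≤c , πa<b , a<ρb) = sw in
    r′ , a , b , c′ , ℕP.<-≤-trans r′<r r≤a , ℕP.≤-<-trans b≤c c<c′ , inj₁ (c′<πr′ , πa<b , a<ρb , ρ<r′)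

  AgreesAbove : Fin n → Set
  AgreesAbove p = ∀ i → i < p → ∀ j → j ≢ col-of i → B i j ≡ 0ℤ

  -- Below such rows, a +1 of row p off its 1 lies above the 1 of its column,
  -- and a -1 lies below it: otherwise the column would need a compensating
  -- entry above row p.
  agrees-above-nonzero : ∀ {p i j} → AgreesAbove p → i < p → B i j ≢ 0ℤ → row-of j ≡ i
  agrees-above-nonzero {i = i} {j} agree i<p nz with j F.≟ col-of i
  ... | yes j≡ = inverse-of π j≡
  ... | no j≢  = ⊥-elim (nz (agree i i<p j j≢))

  plus-points-down : ∀ {p} → AgreesAbove p → ∀ j → j ≢ col-of p → B p j ≡ 1ℤ → p < row-of j
  plus-points-down {p} agree j j≢ e with above-or-below p j j≢
  ... | inj₁ p<ρ = p<ρ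
  ... | inj₂ ρ<p with vec-minus-between (λ i → B i j) (col-alt j) (row-of j) p (col-one j) e ρ<p
  ...   | i , ρ<i , i<p , eᵢ with agrees-above-nonzero agree i<p (λ z → -1≢0 (trans (sym eᵢ) z))
  ...     | ρ≡i = ⊥-elim (<⇒≢ ρ<i ρ≡i)

  minus-points-up : ∀ {p} → AgreesAbove p → ∀ j → j ≢ col-of p → B p j ≡ -1ℤ → row-of j < p
  minus-points-up {p} agree j j≢ e with above-or-below p j j≢
  ... | inj₂ ρ<p = ρ<p
  ... | inj₁ p<ρ with vec-minus-has-plus-before (λ i → B i j) (col-alt j) p e
  ...   | i , i<p , eᵢ with agrees-above-nonzero agree i<p (λ z → 1≢0 (trans (sym eᵢ) z))
  ...     | refl = ⊥-elim (ℕP.<-asym i<p p<ρ)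

  -- The staircase starts in a row p below agreeing rows, from an adjacent
  -- pair of opposite entries on one side of the row's 1.  Left of it, the
  -- pair +1 at k, -1 at l yields the north-east corner (p, l) and a -1 below
  -- row p in column k; right of it, -1 at k, +1 at l yields the north-west
  -- corner (p, k) and a -1 below row p in column l.
  start-left : ∀ {p k l} → AgreesAbove p → k < l → l < col-of p →
    B p k ≡ 1ℤ → B p l ≡ -1ℤ → HasPinwheel π
  start-left {p} {k} {l} agree k<l l<πp eₖ eₗ
    with vec-minus-between (λ i → B i k) (col-alt k) p (row-of k) eₖ (col-one k)
           (plus-points-down agree k (left⇒off (ℕP.<-trans k<l l<πp)) eₖ)
  ... | r′ , p<r′ , r′<ρ , e′ =
    descend-left (<-wellFounded k) e′ r′<ρ
      (p , l , ℕP.≤-refl , ℕP.≤-refl , l<πp , minus-points-up agree l (left⇒off l<πp) eₗ) p<r′ k<l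

  start-right : ∀ {p k l} → AgreesAbove p → col-of p < k → k < l →
    B p k ≡ -1ℤ → B p l ≡ 1ℤ → HasPinwheel π
  start-right {p} {k} {l} agree πp<k k<l eₖ eₗ
    with vec-minus-between (λ i → B i l) (col-alt l) p (row-of l) eₗ (col-one l)
           (plus-points-down agree l (right⇒off (ℕP.<-trans πp<k k<l)) eₗ)
  ... | r′ , p<r′ , r′<ρ , e′ =
    descend-right (>-wellFounded l) e′ r′<ρ
      (p , k , ℕP.≤-refl , ℕP.≤-refl , πp<k , minus-points-up agree k (right⇒off πp<k) eₖ) p<r′ k<l

  Deviates : Fin n → Set
  Deviates i = Σ (Fin n) λ j → j ≢ col-of i × B i j ≢ 0ℤ

  deviates? : ∀ i → Dec (Deviates i)
  deviates? i = any? (λ j → ¬? (j F.≟ col-of i) ×-dec ¬? (B i j ℤ.≟ 0ℤ))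

  start : ∀ {p} → AgreesAbove p → Deviates p → HasPinwheel π
  start {p} agree (j , j≢ , nz) with vec-entry (B p) (row-alt p) j | left-or-right p j j≢
  ... | inj₁ z | _ = ⊥-elim (nz z)
  ... | inj₂ (inj₁ e) | inj₁ j<πp =
    let (l , j<l , l<πp , eₗ) = vec-minus-between (B p) (row-alt p) j (col-of p) e (row-one p) j<πp
    in start-left agree j<l l<πp e eₗ
  ... | inj₂ (inj₂ e) | inj₁ j<πp =
    let (k , k<j , eₖ) = vec-minus-has-plus-before (B p) (row-alt p) j e
    in start-left agree k<j j<πp eₖ e
  ... | inj₂ (inj₁ e) | inj₂ πp<j =
    let (k , πp<k , k<j , eₖ) = vec-minus-between (B p) (row-alt p) (col-of p) j (row-one p) e πp<j
    in start-right agree πp<k k<j eₖ e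
  ... | inj₂ (inj₂ e) | inj₂ πp<j =
    let (l , j<l , eₗ) = vec-minus-has-plus-after (B p) (row-alt p) j e
    in start-right agree πp<j j<l e eₗ

  topmost-deviation : ∀ i → Acc _<_ i → Deviates i → Σ (Fin n) λ p → AgreesAbove p × Deviates p
  topmost-deviation i (acc higher) dev with any? (λ i′ → (i′ F.<? i) ×-dec deviates? i′)
  ... | yes (i′ , i′<i , dev′) = topmost-deviation i′ (higher i′<i) dev′
  ... | no none = i , agree , dev
    where
    agree : AgreesAbove i
    agree i′ i′<i j j≢ with B i′ j ℤ.≟ 0ℤ
    ... | yes z = z
    ... | no nz = ⊥-elim (none (i′ , i′<i , j , j≢ , nz))

  deviation⇒pinwheel : ∀ {i} → Deviates i → HasPinwheel π
  deviation⇒pinwheel {i} dev =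
    let (p , agree , devₚ) = topmost-deviation i (<-wellFounded i) dev in start agree devₚ

-- Necessity: an ASM extension B keeps the 1s of permMatrix π and differs
-- from it at a cell off those 1s, i.e. some row of B deviates.
extension⇒pinwheel : ∀ {n} (π : Permutation′ n) →
  Σ (Matrix n) (λ B → IsASMExtension (permMatrix π) B) → HasPinwheel π
extension⇒pinwheel π (B , (_ , row-alt , col-alt) , (i , j , differs) , keeps) =
  Staircase.deviation⇒pinwheel π B row-alt col-alt row-one (j , j≢ , nz)
  where
  row-one : ∀ i → B i (π ⟨$⟩ʳ i) ≡ 1ℤ
  row-one i = trans (keeps i (π ⟨$⟩ʳ i) (λ z → 1≢0 (trans (sym (permMatrix-row-one π i)) z)))
                    (permMatrix-row-one π i)
  j≢ : j ≢ π ⟨$⟩ʳ i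
  j≢ refl = differs (trans (row-one i) (sym (permMatrix-row-one π i)))
  nz : B i j ≢ 0ℤ
  nz z = differs (trans z (sym (permMatrix-row-zero π i j j≢)))

-- Maximality is equivalent to the absence of a pinwheel.
corollary6p2 : (n : ℕ) → 1 ≤ n → (π : Permutation′ n) →
    IsMaximalASM (permMatrix π) ⇔
    (¬ (Σ (Fin n) λ p → Σ (Fin n) λ q → Σ (Fin n) λ k → Σ (Fin n) λ l →
          p < q × k < l ×
          ((l < π ⟨$⟩ʳ p × π ⟨$⟩ʳ q < k × q < π ⟨$⟩ˡ k × π ⟨$⟩ˡ l < p)
           ⊎ (π ⟨$⟩ʳ p < k × l < π ⟨$⟩ʳ q × π ⟨$⟩ˡ k < p × q < π ⟨$⟩ˡ l))))
corollary6p2 n _ π = mk⇔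
  (λ maximal pinwheel → proj₂ maximal (pinwheel⇒extension π pinwheel))
  (λ no-pinwheel → permMatrix-isASM π , λ extension → no-pinwheel (extension⇒pinwheel π extension))
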